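{- Let $G$ be a finite simple graph having no connected component isomorphic to $K_2$ (an isolated edge) and no connected component isomorphic to $K_3$ (an isolated triangle). Then the edges of $G$ can be colored with $a(G)$ colors so that for each color, the edges of that color form a forest none of whose components consists of a single edge.
   Context: The arboricity $a(G)$ is the least number of forests into which the edge set of $G$ can be decomposed, i.e. the least number of colors in an edge coloring of $G$ in which every color class induces a forest. -}

module Defs where

open import Data.Nat using (ℕ; zero; suc; _≤_)
open import Data.Fin using (Fin; zero; suc; inject₁; fromℕ)
open import Data.Bool using (Bool; true; false)
open import Data.Product using (Σ; ∃; _×_; _,_)
open import Data.Sum using (_⊎_)
open import Relation.Binary.PropositionalEquality using (_≡_; _≢_)
open import Function.Definitions using (Injective)
open import Relation.Nullary using (¬_)

record Graph (n : ℕ) : Set where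
  field
    adj    : Fin n → Fin n → Bool
    sym    : ∀ u v → adj u v ≡ adj v u
    irrefl : ∀ v → adj v v ≡ false

open Graph public

Edge : ∀ {n} → Graph n → Fin n → Fin n → Set
Edge G u v = adj G u v ≡ true

-- An edge colouring with k colours: a colour for every ordered pair,
-- required to be symmetric on edges (so it is a colouring of unordered edges).
record EdgeColouring {n} (G : Graph n) (k : ℕ) : Set where
  field
    colour    : Fin n → Fin n → Fin k
    colourSym : ∀ u v → Edge G u v → colour u v ≡ colour v u

open EdgeColouring public

ColourEdge : ∀ {n k} {G : Graph n} → EdgeColouring G k → Fin k → Fin n → Fin n → Set
ColourEdge {G = G} c i u v = Edge G u v × colour c u v ≡ i

-- A cycle in a (simple) relation R on Fin n: pairwise distinct vertices
-- x₀, …, x_{m+2} (length at least 3) with x_j R x_{j+1} and x_{m+2} R x₀.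
Cycle : ∀ {n} → (Fin n → Fin n → Set) → Set
Cycle {n} R =
  Σ ℕ λ m → Σ (Fin (suc (suc (suc m))) → Fin n) λ x →
    Injective _≡_ _≡_ x
    × (∀ (j : Fin (suc (suc m))) → R (x (inject₁ j)) (x (suc j)))
    × R (x (fromℕ (suc (suc m)))) (x zero)

Forest : ∀ {n} → (Fin n → Fin n → Set) → Set
Forest R = ¬ Cycle R

IsForestColouring : ∀ {n k} {G : Graph n} → EdgeColouring G k → Set
IsForestColouring {k = k} c = ∀ (i : Fin k) → Forest (ColourEdge c i)

HasForestColouring : ∀ {n} → Graph n → ℕ → Set
HasForestColouring G k = Σ (EdgeColouring G k) IsForestColouring

IsArboricity : ∀ {n} → Graph n → ℕ → Set
IsArboricity G k = HasForestColouring G k × (∀ j → HasForestColouring G j → k ≤ j)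

-- In colour class i, no component consists of a single edge: every edge uv of
-- colour i has another edge of colour i incident to u or to v.
NoSingleEdgeComponent : ∀ {n k} {G : Graph n} → EdgeColouring G k → Set
NoSingleEdgeComponent {n} {k} c =
  ∀ (i : Fin k) (u v : Fin n) → ColourEdge c i u v →
    (Σ (Fin n) λ w → w ≢ v × ColourEdge c i u w)
    ⊎ (Σ (Fin n) λ w → w ≢ u × ColourEdge c i v w)

-- G has a connected component isomorphic to K₂: an edge uv such that every
-- neighbour of u or v lies in {u, v}.
HasK2Component : ∀ {n} → Graph n → Set
HasK2Component {n} G =
  Σ (Fin n) λ u → Σ (Fin n) λ v → Edge G u v
    × (∀ w → Edge G u w → w ≡ v)
    × (∀ w → Edge G v w → w ≡ u)

-- G has a connected component isomorphic to K₃: a triangle uvw such that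
-- every neighbour of u, v or w lies in {u, v, w}.
HasK3Component : ∀ {n} → Graph n → Set
HasK3Component {n} G =
  Σ (Fin n) λ u → Σ (Fin n) λ v → Σ (Fin n) λ w →
    Edge G u v × Edge G v w × Edge G u w
    × (∀ x → Edge G u x ⊎ Edge G v x ⊎ Edge G w x → x ≡ u ⊎ x ≡ v ⊎ x ≡ w)

-- Start from any forest colouring and remove the isolated edges (single-edge components of
-- colour classes) one at a time without creating new ones. Recolouring one edge keeps every
-- colour class a forest as long as the edge joins two components of its new class. For an
-- isolated edge uv of colour i and another edge uz of colour j, recolour uz to i unless this
-- isolates a neighbouring j-edge. If that fails at both u and v, the j-component of u has
-- radius at most 2: either it misses v, and uv itself can be recoloured to j, or it is a path
-- u – z – v. Such a cherry is resolved through a further neighbour of u, v or z, which exists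
-- since u, v, z do not span a K₃ component; u or v has a further neighbour since uv is not a
-- K₂ component.
module Submission where

open import Defs renaming (sym to adj-sym)
open import Data.Bool using (true; if_then_else_)
import Data.Bool.Properties as Bool
open import Data.Empty using (⊥; ⊥-elim)
open import Data.Fin using (Fin; zero; suc; toℕ; inject₁; fromℕ; _≟_)
import Data.Fin as Fin
open import Data.Fin.Properties using (any?; all?; inject₁-injective; toℕ-inject₁; fromℕ≢inject₁)
open import Data.Nat using (ℕ; zero; suc; _+_; _≤_; _<_; z≤n; s≤s; s≤s⁻¹)
import Data.Nat.Properties as ℕ
open import Data.Product using (Σ; Σ-syntax; _×_; _,_; proj₁; proj₂)
import Data.Product as Product
open import Data.Sum using (_⊎_; inj₁; inj₂; [_,_]′)
import Data.Sum as Sum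
open import Function using (_∘_; id)
open import Function.Bundles using (_⇔_; mk⇔; module Equivalence)
open import Function.Definitions using (Injective)
open import Function.Properties.Equivalence using (⇔-setoid)
open import Level using (0ℓ)
open import Relation.Binary.Bundles using (Setoid)
open import Relation.Binary.PropositionalEquality using (_≡_; _≢_; refl; sym; trans; cong; cong₂; subst)
open import Relation.Nullary using (¬_; Dec; yes; no; does; contradiction)
open import Relation.Nullary.Decidable
  using (_×-dec_; _⊎-dec_; _→-dec_; ¬?; dec-true; dec-false; does-⇔; decidable-stable)
open import Relation.Unary using (Decidable)

private
  module ⇔ = Setoid (⇔-setoid 0ℓ)

  variable
    n M : ℕ
    a b p q u v w x y z : Fin n

⇔-along-prefix : (Q : Fin (suc M) → Set) (i : Fin (suc M)) →
                 (∀ j → j Fin.< i → Q (inject₁ j) ⇔ Q (suc j)) → Q zero ⇔ Q i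
⇔-along-prefix Q zero    step = ⇔.refl
⇔-along-prefix {suc M} Q (suc i) step =
  ⇔.trans (step zero (s≤s z≤n)) (⇔-along-prefix (Q ∘ suc) i (λ j j<i → step (suc j) (s≤s j<i)))

⇔-along-suffix : (Q : Fin (suc M) → Set) (i : Fin (suc M)) →
                 (∀ j → i Fin.≤ j → Q (inject₁ j) ⇔ Q (suc j)) → Q i ⇔ Q (fromℕ M)
⇔-along-suffix Q zero    step = ⇔-along-prefix Q _ (λ j _ → step j z≤n)
⇔-along-suffix {suc M} Q (suc i) step = ⇔-along-suffix (Q ∘ suc) i (λ j i≤j → step (suc j) (s≤s i≤j))

⇔-around-cycle : (Q : Fin (suc M) → Set) (j₀ : Fin M) →
                 (∀ j → j ≢ j₀ → Q (inject₁ j) ⇔ Q (suc j)) → Q (fromℕ M) ⇔ Q zero →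
                 Q (inject₁ j₀) ⇔ Q (suc j₀)
⇔-around-cycle Q j₀ step closing = ⇔.sym (⇔.trans (⇔.trans after closing) before)
  where
  before : Q zero ⇔ Q (inject₁ j₀)
  before = ⇔-along-prefix Q (inject₁ j₀) λ j j<j₀ →
    step j λ { refl → ℕ.<-irrefl (sym (toℕ-inject₁ j)) j<j₀ }
  after : Q (suc j₀) ⇔ Q (fromℕ _)
  after = ⇔-along-suffix Q (suc j₀) λ j j₀<j → step j λ { refl → ℕ.n≮n _ j₀<j }

SameEdge : Fin n → Fin n → Fin n → Fin n → Set
SameEdge x y a b = (x ≡ a × y ≡ b) ⊎ (x ≡ b × y ≡ a)

sameEdge? : (x y a b : Fin n) → Dec (SameEdge x y a b)
sameEdge? x y a b = ((x ≟ a) ×-dec (y ≟ b)) ⊎-dec ((x ≟ b) ×-dec (y ≟ a))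

SameEdge-sym : SameEdge x y a b → SameEdge y x a b
SameEdge-sym (inj₁ (x≡a , y≡b)) = inj₂ (y≡b , x≡a)
SameEdge-sym (inj₂ (x≡b , y≡a)) = inj₁ (y≡a , x≡b)

SameEdge-joint : SameEdge x y a b → SameEdge p q a b → SameEdge x y p q
SameEdge-joint (inj₁ (refl , refl)) (inj₁ (refl , refl)) = inj₁ (refl , refl)
SameEdge-joint (inj₁ (refl , refl)) (inj₂ (refl , refl)) = inj₂ (refl , refl)
SameEdge-joint (inj₂ (refl , refl)) (inj₁ (refl , refl)) = inj₂ (refl , refl)
SameEdge-joint (inj₂ (refl , refl)) (inj₂ (refl , refl)) = inj₁ (refl , refl)

SameEdge-otherEnd : a ≢ b → SameEdge x q a b → SameEdge x w a b → w ≡ q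
SameEdge-otherEnd a≢b (inj₁ (refl , refl)) (inj₁ (_ , refl))   = refl
SameEdge-otherEnd a≢b (inj₁ (refl , refl)) (inj₂ (a≡b , _))    = contradiction a≡b a≢b
SameEdge-otherEnd a≢b (inj₂ (refl , refl)) (inj₁ (b≡a , _))    = contradiction (sym b≡a) a≢b
SameEdge-otherEnd a≢b (inj₂ (refl , refl)) (inj₂ (_ , refl))   = refl

SameEdge-endpoints : x ≢ y → SameEdge x p a b → SameEdge y q a b → SameEdge x y a b
SameEdge-endpoints x≢y (inj₁ (refl , _)) (inj₁ (refl , _)) = contradiction refl x≢y
SameEdge-endpoints x≢y (inj₁ (refl , _)) (inj₂ (refl , _)) = inj₁ (refl , refl)
SameEdge-endpoints x≢y (inj₂ (refl , _)) (inj₁ (refl , _)) = inj₂ (refl , refl)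
SameEdge-endpoints x≢y (inj₂ (refl , _)) (inj₂ (refl , _)) = contradiction refl x≢y

consecutive-unique : (j j′ : Fin M) → SameEdge (inject₁ j) (suc j) (inject₁ j′) (suc j′) → j ≡ j′
consecutive-unique j j′ (inj₁ (e , _))    = inject₁-injective e
consecutive-unique j j′ (inj₂ (e₁ , e₂)) = ⊥-elim (ℕ.<-asym j′<j j<j′)
  where
  j′<j : toℕ j′ < toℕ j
  j′<j = ℕ.≤-reflexive (trans (sym (cong toℕ e₁)) (toℕ-inject₁ j))
  j<j′ : toℕ j < toℕ j′
  j<j′ = ℕ.≤-reflexive (trans (cong toℕ e₂) (toℕ-inject₁ j′))

consecutive-not-closing : (j : Fin (suc (suc M))) →
                          ¬ SameEdge (inject₁ j) (suc j) (fromℕ (suc (suc M))) zero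
consecutive-not-closing j     (inj₁ (e , _))  = fromℕ≢inject₁ (sym e)
consecutive-not-closing zero    (inj₂ (_ , ()))
consecutive-not-closing (suc j) (inj₂ (() , _))

module _ {m : ℕ} {x : Fin (suc (suc (suc m))) → Fin n} (x-inj : Injective _≡_ _≡_ x) where

  private
    SameEdge-injective : SameEdge (x a) (x b) (x p) (x q) → SameEdge a b p q
    SameEdge-injective = Sum.map (Product.map x-inj x-inj) (Product.map x-inj x-inj)

  step-unique : ∀ {a b} j j′ → SameEdge (x (inject₁ j)) (x (suc j)) a b →
                SameEdge (x (inject₁ j′)) (x (suc j′)) a b → j ≡ j′
  step-unique j j′ e e′ = consecutive-unique j j′ (SameEdge-injective (SameEdge-joint e e′))

  step-not-closing : ∀ {a b} j → SameEdge (x (inject₁ j)) (x (suc j)) a b →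
                     ¬ SameEdge (x (fromℕ (suc (suc m)))) (x zero) a b
  step-not-closing j e e′ = consecutive-not-closing j (SameEdge-injective (SameEdge-joint e e′))

Forest-antimono : {R R′ : Fin n → Fin n → Set} → (∀ {x y} → R′ x y → R x y) → Forest R → Forest R′
Forest-antimono R′⊆R forest (m , x , x-inj , steps , closing) =
  forest (m , x , x-inj , R′⊆R ∘ steps , R′⊆R closing)

Forest-addBridge : {R R′ : Fin n → Fin n → Set} (P : Fin n → Set) → Forest R →
                   (∀ {x y} → R x y → P x ⇔ P y) → P a → ¬ P b →
                   (∀ {x y} → R′ x y → R x y ⊎ SameEdge x y a b) → Forest R′
Forest-addBridge {a = a} {b = b} {R = R} {R′ = R′} P forest P-invariant Pa ¬Pb R′⊆R+ab
                 (m , x , x-inj , steps , closing) =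
  conclude (sameEdge? (x (fromℕ _)) (x zero) a b)
  where
  Q : Fin (suc (suc (suc m))) → Set
  Q = P ∘ x

  toR : R′ p q → ¬ SameEdge p q a b → R p q
  toR r ¬ab = [ id , (λ ab → contradiction ab ¬ab) ]′ (R′⊆R+ab r)

  not-across : SameEdge p q a b → ¬ (P p ⇔ P q)
  not-across (inj₁ (refl , refl)) P⇔ = ¬Pb (Equivalence.to P⇔ Pa)
  not-across (inj₂ (refl , refl)) P⇔ = ¬Pb (Equivalence.from P⇔ Pa)

  step⇔ : ∀ j → ¬ SameEdge (x (inject₁ j)) (x (suc j)) a b → Q (inject₁ j) ⇔ Q (suc j)
  step⇔ j ¬ab = P-invariant (toR (steps j) ¬ab)

  conclude : Dec (SameEdge (x (fromℕ _)) (x zero) a b) → ⊥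
  conclude (yes closing-ab) =
    not-across closing-ab (⇔.sym (⇔-along-prefix Q _ λ j _ →
      step⇔ j λ ab → step-not-closing x-inj j ab closing-ab))
  conclude (no ¬closing-ab) with any? (λ j → sameEdge? (x (inject₁ j)) (x (suc j)) a b)
  ... | no ¬step-ab =
    forest (m , x , x-inj , (λ j → toR (steps j) (¬step-ab ∘ (j ,_))) , toR closing ¬closing-ab)
  ... | yes (j₀ , step-ab) =
    not-across step-ab (⇔-around-cycle Q j₀
      (λ j j≢j₀ → step⇔ j (j≢j₀ ∘ λ ab → step-unique x-inj j j₀ ab step-ab))
      (P-invariant (toR closing ¬closing-ab)))

∑ : (Fin M → ℕ) → ℕ
∑ {zero}  f = 0
∑ {suc M} f = f zero + ∑ (f ∘ suc)

∑-mono-≤ : {f g : Fin M → ℕ} → (∀ i → f i ≤ g i) → ∑ f ≤ ∑ g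
∑-mono-≤ {zero}  f≤g = z≤n
∑-mono-≤ {suc M} f≤g = ℕ.+-mono-≤ (f≤g zero) (∑-mono-≤ (f≤g ∘ suc))

∑-mono-< : {f g : Fin M → ℕ} → (∀ i → f i ≤ g i) → ∀ i → f i < g i → ∑ f < ∑ g
∑-mono-< f≤g zero    f<g = ℕ.+-mono-<-≤ f<g (∑-mono-≤ (f≤g ∘ suc))
∑-mono-< f≤g (suc i) f<g = ℕ.+-mono-≤-< (f≤g zero) (∑-mono-< (f≤g ∘ suc) i f<g)

⟦_⟧ : {A : Set} → Dec A → ℕ
⟦ yes _ ⟧ = 1
⟦ no _ ⟧  = 0

⟦⟧-mono-≤ : {A B : Set} → (A → B) → (a? : Dec A) (b? : Dec B) → ⟦ a? ⟧ ≤ ⟦ b? ⟧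
⟦⟧-mono-≤ A⇒B (yes a) (yes _) = ℕ.≤-refl
⟦⟧-mono-≤ A⇒B (yes a) (no ¬b) = contradiction (A⇒B a) ¬b
⟦⟧-mono-≤ A⇒B (no _)  _       = z≤n

⟦⟧-mono-< : {A B : Set} → ¬ A → B → (a? : Dec A) (b? : Dec B) → ⟦ a? ⟧ < ⟦ b? ⟧
⟦⟧-mono-< ¬a b (yes a) _      = contradiction a ¬a
⟦⟧-mono-< ¬a b (no _) (yes _) = ℕ.≤-refl
⟦⟧-mono-< ¬a b (no _) (no ¬b) = contradiction b ¬b

module _ (G : Graph n) {k : ℕ} where

  private
    variable
      i j l : Fin k

  edge? : ∀ x y → Dec (Edge G x y)
  edge? x y = adj G x y Bool.≟ true

  Edge-sym : Edge G x y → Edge G y x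
  Edge-sym {x = x} {y} = trans (adj-sym G y x)

  Edge-irrefl : Edge G x y → x ≢ y
  Edge-irrefl {x = x} e refl = contradiction (trans (sym (irrefl G x)) e) λ ()

  NbrOutside : (Fin n → Set) → Fin n → Set
  NbrOutside T p = Σ[ y ∈ Fin n ] Edge G p y × ¬ T y

  nbrOutside? : {T : Fin n → Set} → Decidable T → ∀ p → Dec (NbrOutside T p)
  nbrOutside? T? p = any? λ y → edge? p y ×-dec ¬? (T? y)

  nbrs-within : {T : Fin n → Set} → Decidable T → ¬ NbrOutside T p → ∀ y → Edge G p y → T y
  nbrs-within T? none y py = decidable-stable (T? y) λ ¬Ty → none (y , py , ¬Ty)

  Colouring : Set
  Colouring = EdgeColouring G k

  module _ (c : Colouring) where

    colour-sym : Edge G x y → colour c y x ≡ colour c x y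
    colour-sym e = sym (colourSym c _ _ e)

    colour-SameEdge : Edge G x y → SameEdge x y a b → colour c x y ≡ colour c a b
    colour-SameEdge e (inj₁ (refl , refl)) = refl
    colour-SameEdge e (inj₂ (refl , refl)) = colour-sym (Edge-sym e)

    colourEdge? : (i : Fin k) (x y : Fin n) → Dec (ColourEdge c i x y)
    colourEdge? i x y = edge? x y ×-dec (colour c x y ≟ i)

    ColourEdge-sym : ColourEdge c i x y → ColourEdge c i y x
    ColourEdge-sym (e , cᵢ) = Edge-sym e , trans (colour-sym e) cᵢ

    ColourEdge-irrefl : ColourEdge c i x y → x ≢ y
    ColourEdge-irrefl = Edge-irrefl ∘ proj₁

    NbrsIn₁ : Fin k → Fin n → Fin n → Set
    NbrsIn₁ i x a = ∀ w → ColourEdge c i x w → w ≡ a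

    NbrsIn₂ : Fin k → Fin n → Fin n → Fin n → Set
    NbrsIn₂ i x a b = ∀ w → ColourEdge c i x w → w ≡ a ⊎ w ≡ b

    nbrsIn₁? : (i : Fin k) (x a : Fin n) → Dec (NbrsIn₁ i x a)
    nbrsIn₁? i x a = all? λ w → colourEdge? i x w →-dec w ≟ a

    nbrsIn₂? : (i : Fin k) (x a b : Fin n) → Dec (NbrsIn₂ i x a b)
    nbrsIn₂? i x a b = all? λ w → colourEdge? i x w →-dec (w ≟ a ⊎-dec w ≟ b)

    NbrsIn₁-from : ¬ (Σ[ w ∈ Fin n ] w ≢ a × ColourEdge c i x w) → NbrsIn₁ i x a
    NbrsIn₁-from {a = a} none w r = decidable-stable (w ≟ a) λ w≢a → none (w , w≢a , r)

    IsolatedIn : Fin k → Fin n → Fin n → Set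
    IsolatedIn i x y = ColourEdge c i x y × NbrsIn₁ i x y × NbrsIn₁ i y x

    IsolatedEdge : Fin n → Fin n → Set
    IsolatedEdge x y = Σ[ i ∈ Fin k ] IsolatedIn i x y

    isolatedEdge? : (x y : Fin n) → Dec (IsolatedEdge x y)
    isolatedEdge? x y = any? λ i → colourEdge? i x y ×-dec nbrsIn₁? i x y ×-dec nbrsIn₁? i y x

    IsolatedIn-sym : IsolatedIn i x y → IsolatedIn i y x
    IsolatedIn-sym (r , x-nbrs , y-nbrs) = ColourEdge-sym r , y-nbrs , x-nbrs

    IsolatedEdge-sym : IsolatedEdge x y → IsolatedEdge y x
    IsolatedEdge-sym = Product.map₂ IsolatedIn-sym

    IsolatedEdge-SameEdge : SameEdge x y a b → IsolatedEdge x y → IsolatedEdge a b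
    IsolatedEdge-SameEdge (inj₁ (refl , refl)) = id
    IsolatedEdge-SameEdge (inj₂ (refl , refl)) = IsolatedEdge-sym

    ¬IsolatedEdge-fork : ColourEdge c i x y → ColourEdge c i x w → w ≢ y → ¬ IsolatedEdge x y
    ¬IsolatedEdge-fork xy xw w≢y (_ , xy′ , x-nbrs , _) =
      w≢y (x-nbrs _ (proj₁ xw , trans (proj₂ xw) (trans (sym (proj₂ xy)) (proj₂ xy′))))

    IsolatedIn-colour≢ : IsolatedIn i u v → ColourEdge c j u z → z ≢ v → j ≢ i
    IsolatedIn-colour≢ (_ , u-nbrs , _) uz z≢v refl = z≢v (u-nbrs _ uz)

    -- py becomes an isolated edge of colour j once the edge pq is removed from that colour.
    IsolatedWithout : Fin k → Fin n → Fin n → Fin n → Set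
    IsolatedWithout j p q y = ColourEdge c j p y × y ≢ q × NbrsIn₂ j p y q × NbrsIn₁ j y p

    LeavesIsolatedEdge : Fin k → Fin n → Fin n → Set
    LeavesIsolatedEdge j a b = Σ[ y ∈ Fin n ] (IsolatedWithout j a b y ⊎ IsolatedWithout j b a y)

    leavesIsolatedEdge? : (j : Fin k) (a b : Fin n) → Dec (LeavesIsolatedEdge j a b)
    leavesIsolatedEdge? j a b = any? λ y → without? a b y ⊎-dec without? b a y
      where
      without? : ∀ p q y → Dec (IsolatedWithout j p q y)
      without? p q y = colourEdge? j p y ×-dec ¬? (y ≟ q) ×-dec nbrsIn₂? j p y q ×-dec nbrsIn₁? j y p

    -- xy shares the endpoint x with ab and becomes isolated once ab leaves colour j.
    Orphan : Fin k → Fin n → Fin n → Fin n → Fin n → Set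
    Orphan j a b x y = Σ[ q ∈ Fin n ] SameEdge x q a b × IsolatedWithout j x q y

    Orphan⇒LeavesIsolatedEdge : Orphan j a b x y → LeavesIsolatedEdge j a b
    Orphan⇒LeavesIsolatedEdge (_ , inj₁ (refl , refl) , orphan) = _ , inj₁ orphan
    Orphan⇒LeavesIsolatedEdge (_ , inj₂ (refl , refl) , orphan) = _ , inj₂ orphan

    IsolatedIn⇒¬Orphan : IsolatedIn j a b → ¬ Orphan j a b x y
    IsolatedIn⇒¬Orphan (_ , a-nbrs , _) (_ , inj₁ (refl , refl) , ay , y≢b , _) = y≢b (a-nbrs _ ay)
    IsolatedIn⇒¬Orphan (_ , _ , b-nbrs) (_ , inj₂ (refl , refl) , by , y≢a , _) = y≢a (b-nbrs _ by)

  recolour : Colouring → Fin n → Fin n → Fin k → Colouring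
  recolour c a b l = record { colour = colour′ ; colourSym = colourSym′ }
    where
    colour′ : Fin n → Fin n → Fin k
    colour′ x y = if does (sameEdge? x y a b) then l else colour c x y

    colourSym′ : ∀ x y → Edge G x y → colour′ x y ≡ colour′ y x
    colourSym′ x y e = cong₂ (λ t col → if t then l else col)
      (does-⇔ (mk⇔ SameEdge-sym SameEdge-sym) (sameEdge? x y a b) (sameEdge? y x a b)) (colourSym c x y e)

  module Recolour (c : Colouring) (a b : Fin n) (l : Fin k) where

    c′ : Colouring
    c′ = recolour c a b l

    colour-on : SameEdge x y a b → colour c′ x y ≡ l
    colour-on {x = x} {y} ab =
      cong (λ t → if t then l else colour c x y) (dec-true (sameEdge? x y a b) ab)

    colour-off : ¬ SameEdge x y a b → colour c′ x y ≡ colour c x y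
    colour-off {x = x} {y} ¬ab =
      cong (λ t → if t then l else colour c x y) (dec-false (sameEdge? x y a b) ¬ab)

    ColourEdge⁺ : ColourEdge c i x y → ¬ SameEdge x y a b → ColourEdge c′ i x y
    ColourEdge⁺ (e , cᵢ) ¬ab = e , trans (colour-off ¬ab) cᵢ

    ColourEdge⁻-off : ¬ SameEdge x y a b → ColourEdge c′ i x y → ColourEdge c i x y
    ColourEdge⁻-off ¬ab (e , c′ᵢ) = e , trans (sym (colour-off ¬ab)) c′ᵢ

    ColourEdge⁻ : ColourEdge c′ i x y → ColourEdge c i x y ⊎ (SameEdge x y a b × i ≡ l)
    ColourEdge⁻ {x = x} {y = y} r with sameEdge? x y a b
    ... | yes ab = inj₂ (ab , trans (sym (proj₂ r)) (colour-on ab))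
    ... | no ¬ab = inj₁ (ColourEdge⁻-off ¬ab r)

    ColourEdge⁻-≢ : i ≢ l → ColourEdge c′ i x y → ColourEdge c i x y
    ColourEdge⁻-≢ i≢l r = [ id , (λ (_ , i≡l) → contradiction i≡l i≢l) ]′ (ColourEdge⁻ r)

    Forest-recolour : IsForestColouring c → (P : Fin n → Set) →
                      (∀ {x y} → ColourEdge c l x y → P x → P y) → P a → ¬ P b → IsForestColouring c′
    Forest-recolour fc P P-closed Pa ¬Pb i with i ≟ l
    ... | yes refl = Forest-addBridge {R = ColourEdge c l} {R′ = ColourEdge c′ l} P (fc l)
                       (λ r → mk⇔ (P-closed r) (P-closed (ColourEdge-sym c r))) Pa ¬Pb
                       (Sum.map₂ proj₁ ∘ ColourEdge⁻)
    ... | no i≢l = Forest-antimono {R = ColourEdge c i} (ColourEdge⁻-≢ i≢l) (fc i)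

    private
      endpoint? : ∀ x → Dec (Σ[ q ∈ Fin n ] SameEdge x q a b)
      endpoint? x = any? λ q → sameEdge? x q a b

      NbrsIn₁⁻ : NbrsIn₁ c′ i x y → (∀ {w} → ColourEdge c i x w → SameEdge x w a b → w ≡ y) →
                 NbrsIn₁ c i x y
      NbrsIn₁⁻ {x = x} nbrs′ on-ab w r with sameEdge? x w a b
      ... | yes xw = on-ab r xw
      ... | no ¬xw = nbrs′ w (ColourEdge⁺ r ¬xw)

      isolated-side : ColourEdge c j a b → ¬ SameEdge x y a b → IsolatedIn c′ i x y →
                      NbrsIn₁ c i x y ⊎ Orphan c j a b x y
      isolated-side {j = j} {x = x} {y = y} {i = i} ab ¬xy (r′ , x-nbrs′ , y-nbrs′)
        with endpoint? x ×-dec i ≟ j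
      ... | no ¬orphan = inj₁ (NbrsIn₁⁻ x-nbrs′ λ r xw → contradiction
              ((_ , xw) , trans (sym (proj₂ r)) (trans (colour-SameEdge c (proj₁ r) xw) (proj₂ ab))) ¬orphan)
      ... | yes ((q , xq) , refl) = inj₂ (q , xq , ColourEdge⁻-off ¬xy r′ , y≢q , x-nbrs ,
              NbrsIn₁⁻ y-nbrs′ λ _ yw →
                contradiction (SameEdge-endpoints (ColourEdge-irrefl c′ r′) xq yw) ¬xy)
        where
        y≢q : y ≢ q
        y≢q refl = ¬xy xq

        x-nbrs : NbrsIn₂ c i x y q
        x-nbrs w r with w ≟ q
        ... | yes w≡q = inj₂ w≡q
        ... | no w≢q = inj₁ (x-nbrs′ w (ColourEdge⁺ r (w≢q ∘ SameEdge-otherEnd (ColourEdge-irrefl c ab) xq)))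

    IsolatedIn⁻ : ColourEdge c j a b → IsolatedIn c′ i x y →
                  SameEdge x y a b ⊎ IsolatedIn c i x y ⊎ Orphan c j a b x y ⊎ Orphan c j a b y x
    IsolatedIn⁻ {x = x} {y = y} ab iso′ with sameEdge? x y a b
    ... | yes xy = inj₁ xy
    ... | no ¬xy
      with isolated-side ab ¬xy iso′ | isolated-side ab (¬xy ∘ SameEdge-sym) (IsolatedIn-sym c′ iso′)
    ...   | inj₂ orphan | _           = inj₂ (inj₂ (inj₁ orphan))
    ...   | inj₁ _      | inj₂ orphan = inj₂ (inj₂ (inj₂ orphan))
    ...   | inj₁ x-nbrs | inj₁ y-nbrs = inj₂ (inj₁ (ColourEdge⁻-off ¬xy (proj₁ iso′) , x-nbrs , y-nbrs))

  record Improvement (c : Colouring) (u v : Fin n) : Set where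
    field
      colouring  : Colouring
      forest     : IsForestColouring colouring
      isolated⊆  : ∀ {x y} → IsolatedEdge colouring x y → IsolatedEdge c x y
      unisolates : ¬ IsolatedEdge colouring u v

  Improvement-sym : {c : Colouring} → Improvement c v u → Improvement c u v
  Improvement-sym better = record
    { colouring = colouring ; forest = forest ; isolated⊆ = isolated⊆
    ; unisolates = unisolates ∘ IsolatedEdge-sym colouring }
    where open Improvement better

  Improvement-via : {c : Colouring} (c₁ : Colouring) →
                    (∀ {x y} → IsolatedEdge c₁ x y → IsolatedEdge c x y ⊎ SameEdge x y z v) →
                    ¬ IsolatedEdge c₁ u v → Improvement c₁ z v → Improvement c u v
  Improvement-via c₁ isolated⊆₁ uv₁ better = record
    { colouring  = colouring
    ; forest     = forest
    ; isolated⊆  = λ iso →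
        [ id , (λ zv → contradiction (IsolatedEdge-SameEdge colouring zv iso) unisolates) ]′
          (isolated⊆₁ (isolated⊆ iso))
    ; unisolates = uv₁ ∘ isolated⊆
    }
    where open Improvement better

  module Attach (c : Colouring) (fc : IsForestColouring c) {i u v} (uv : IsolatedIn c i u v)
                {j z} (uz : ColourEdge c j u z) (z≢v : z ≢ v) where

    open Recolour c u z i public

    private
      ¬uv-uz : ¬ SameEdge u v u z
      ¬uv-uz (inj₁ (_ , v≡z)) = z≢v (sym v≡z)
      ¬uv-uz (inj₂ (u≡z , _)) = ColourEdge-irrefl c uz u≡z

      uz′ : ColourEdge c′ i u z
      uz′ = proj₁ uz , colour-on (inj₁ (refl , refl))

      uv′ : ColourEdge c′ i u v
      uv′ = ColourEdge⁺ (proj₁ uv) ¬uv-uz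

    forest′ : IsForestColouring c′
    forest′ = Forest-recolour fc (λ x → x ≡ u ⊎ x ≡ v) closed (inj₁ refl) z∉
      where
      closed : ∀ {x y} → ColourEdge c i x y → x ≡ u ⊎ x ≡ v → y ≡ u ⊎ y ≡ v
      closed xy (inj₁ refl) = inj₂ (proj₁ (proj₂ uv) _ xy)
      closed xy (inj₂ refl) = inj₁ (proj₂ (proj₂ uv) _ xy)

      z∉ : ¬ (z ≡ u ⊎ z ≡ v)
      z∉ (inj₁ z≡u) = ColourEdge-irrefl c uz (sym z≡u)
      z∉ (inj₂ z≡v) = z≢v z≡v

    uv-attached : ¬ IsolatedEdge c′ u v
    uv-attached = ¬IsolatedEdge-fork c′ uv′ uz′ z≢v

    isolated⁻ : ∀ {x y} → IsolatedEdge c′ x y →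
                IsolatedEdge c x y ⊎ Orphan c j u z x y ⊎ Orphan c j u z y x
    isolated⁻ (i′ , iso′) with IsolatedIn⁻ uz iso′
    ... | inj₁ xy-uz         = contradiction (IsolatedEdge-SameEdge c′ xy-uz (i′ , iso′))
                                             (¬IsolatedEdge-fork c′ uz′ uv′ (z≢v ∘ sym))
    ... | inj₂ (inj₁ iso)    = inj₁ (i′ , iso)
    ... | inj₂ (inj₂ orphan) = inj₂ orphan

  improve-or-leaves : {c : Colouring} → IsForestColouring c → IsolatedIn c i u v → j ≢ i →
                      Improvement c u v ⊎ (∀ {z} → ColourEdge c j u z → LeavesIsolatedEdge c j u z)
  improve-or-leaves {u = u} {v = v} {j = j} {c = c} fc uv j≢i
    with any? (λ z → colourEdge? c j u z ×-dec ¬? (leavesIsolatedEdge? c j u z))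
  ... | no ¬clean = inj₂ λ {z} uz →
          decidable-stable (leavesIsolatedEdge? c j u z) λ ¬leaves → ¬clean (z , uz , ¬leaves)
  ... | yes (z , uz , clean) = inj₁ record
          { colouring  = c′
          ; forest     = forest′
          ; isolated⊆  = λ iso → [ id , (λ orphan → contradiction (leaves orphan) clean) ]′ (isolated⁻ iso)
          ; unisolates = uv-attached
          }
    where
    z≢v : z ≢ v
    z≢v refl = j≢i (trans (sym (proj₂ uz)) (proj₂ (proj₁ uv)))

    open Attach c fc uv uz z≢v

    leaves : ∀ {x y} → Orphan c j u z x y ⊎ Orphan c j u z y x → LeavesIsolatedEdge c j u z
    leaves = [ Orphan⇒LeavesIsolatedEdge c , Orphan⇒LeavesIsolatedEdge c ]′

  improve-by-bridge : {c : Colouring} → IsForestColouring c → IsolatedIn c i u v → (P : Fin n → Set) →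
                      (∀ {x y} → ColourEdge c l x y → P x → P y) → P u → ¬ P v →
                      ColourEdge c l u w → w ≢ v → Improvement c u v
  improve-by-bridge {u = u} {v = v} {l = l} {c = c} fc uv P P-closed Pu ¬Pv uw w≢v = record
    { colouring  = c′
    ; forest     = Forest-recolour fc P P-closed Pu ¬Pv
    ; isolated⊆  = isolated⊆
    ; unisolates = uv-attached
    }
    where
    open Recolour c u v l

    ¬uw-uv : ¬ SameEdge u _ u v
    ¬uw-uv (inj₁ (_ , w≡v)) = w≢v w≡v
    ¬uw-uv (inj₂ (u≡v , _)) = ColourEdge-irrefl c (proj₁ uv) u≡v

    uv-attached : ¬ IsolatedEdge c′ u v
    uv-attached = ¬IsolatedEdge-fork c′ (proj₁ (proj₁ uv) , colour-on (inj₁ (refl , refl)))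
                                        (ColourEdge⁺ uw ¬uw-uv) w≢v

    isolated⊆ : ∀ {x y} → IsolatedEdge c′ x y → IsolatedEdge c x y
    isolated⊆ (i′ , iso′) with IsolatedIn⁻ (proj₁ uv) iso′
    ... | inj₁ xy-uv                = contradiction (IsolatedEdge-SameEdge c′ xy-uv (i′ , iso′)) uv-attached
    ... | inj₂ (inj₁ iso)           = i′ , iso
    ... | inj₂ (inj₂ (inj₁ orphan)) = contradiction orphan (IsolatedIn⇒¬Orphan c uv)
    ... | inj₂ (inj₂ (inj₂ orphan)) = contradiction orphan (IsolatedIn⇒¬Orphan c uv)

  -- The colour-j component of u is the path u – centre – v.
  record Cherry (c : Colouring) (j : Fin k) (u v : Fin n) : Set where
    field
      centre      : Fin n
      left        : ColourEdge c j u centre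
      right       : ColourEdge c j centre v
      left-leaf   : NbrsIn₁ c j u centre
      centre-nbrs : NbrsIn₂ c j centre u v
      right-leaf  : NbrsIn₁ c j v centre

    Vertex : Fin n → Set
    Vertex x = x ≡ u ⊎ x ≡ centre ⊎ x ≡ v

    vertex? : Decidable Vertex
    vertex? x = x ≟ u ⊎-dec x ≟ centre ⊎-dec x ≟ v

    Vertex-closed : ∀ {x y} → ColourEdge c j x y → Vertex x → Vertex y
    Vertex-closed xy (inj₁ refl)        = inj₂ (inj₁ (left-leaf _ xy))
    Vertex-closed xy (inj₂ (inj₁ refl)) = [ inj₁ , inj₂ ∘ inj₂ ]′ (centre-nbrs _ xy)
    Vertex-closed xy (inj₂ (inj₂ refl)) = inj₂ (inj₁ (right-leaf _ xy))

  Cherry-sym : {c : Colouring} → Cherry c j u v → Cherry c j v u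
  Cherry-sym {c = c} ch = record
    { centre      = centre
    ; left        = ColourEdge-sym c right
    ; right       = ColourEdge-sym c left
    ; left-leaf   = right-leaf
    ; centre-nbrs = λ w r → Sum.swap (centre-nbrs w r)
    ; right-leaf  = left-leaf
    }
    where open Cherry ch

  module _ (c : Colouring) {j : Fin k} {u : Fin n}
           (u-leaves : ∀ {z} → ColourEdge c j u z → LeavesIsolatedEdge c j u z) where

    short-branch : ColourEdge c j u z → NbrsIn₁ c j z u ⊎ Σ[ w ∈ Fin n ] IsolatedWithout c j z u w
    short-branch uz with u-leaves uz
    ... | y , inj₂ zy = inj₂ (y , zy)
    ... | w , inj₁ (uw , w≢z , u-nbrs , w-leaf) with u-leaves uw
    ...   | y , inj₂ (wy , y≢u , _) = contradiction (w-leaf _ wy) y≢u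
    ...   | y , inj₁ (uy , y≢w , _ , y-leaf) with u-nbrs _ uy
    ...     | inj₁ y≡w = contradiction y≡w y≢w
    ...     | inj₂ refl = inj₁ y-leaf

    Near : Fin n → Set
    Near y = y ≡ u ⊎ ColourEdge c j u y ⊎ Σ[ z ∈ Fin n ] ColourEdge c j u z × ColourEdge c j z y

    near? : Decidable Near
    near? y = y ≟ u ⊎-dec colourEdge? c j u y ⊎-dec any? λ z → colourEdge? c j u z ×-dec colourEdge? c j z y

    Near-closed : ∀ {x y} → ColourEdge c j x y → Near x → Near y
    Near-closed xy (inj₁ refl)        = inj₂ (inj₁ xy)
    Near-closed xy (inj₂ (inj₁ ux))   = inj₂ (inj₂ (_ , ux , xy))
    Near-closed xy (inj₂ (inj₂ (z , uz , zx))) with short-branch uz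
    ... | inj₁ z-leaf = inj₂ (inj₁ (subst (λ t → ColourEdge c j t _) (z-leaf _ zx) xy))
    ... | inj₂ (w , _ , _ , z-nbrs , w-leaf) with z-nbrs _ zx
    ...   | inj₁ refl = inj₂ (inj₁ (subst (ColourEdge c j u) (sym (w-leaf _ xy)) uz))
    ...   | inj₂ refl = inj₂ (inj₁ xy)

    Near⇒Cherry : (∀ {z} → ColourEdge c j v z → LeavesIsolatedEdge c j v z) →
                  IsolatedIn c i u v → j ≢ i → Near v → Cherry c j u v
    Near⇒Cherry v-leaves uv j≢i (inj₁ v≡u) = contradiction (sym v≡u) (ColourEdge-irrefl c (proj₁ uv))
    Near⇒Cherry v-leaves uv j≢i (inj₂ (inj₁ uvⱼ)) =
      contradiction (trans (sym (proj₂ uvⱼ)) (proj₂ (proj₁ uv))) j≢i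
    Near⇒Cherry v-leaves uv j≢i (inj₂ (inj₂ (z , uz , zv))) with short-branch uz
    ... | inj₁ z-leaf = contradiction (sym (z-leaf _ zv)) (ColourEdge-irrefl c (proj₁ uv))
    ... | inj₂ (w , _ , _ , z-nbrs , w-leaf) with z-nbrs _ zv
    ...   | inj₂ v≡u = contradiction (sym v≡u) (ColourEdge-irrefl c (proj₁ uv))
    ...   | inj₁ refl with v-leaves (ColourEdge-sym c zv)
    ...     | y , inj₁ (vy , y≢z , _) = contradiction (w-leaf _ vy) y≢z
    ...     | y , inj₂ (_ , _ , z-nbrs′ , y-leaf) with z-nbrs′ _ (ColourEdge-sym c uz)
    ...       | inj₂ u≡v = contradiction u≡v (ColourEdge-irrefl c (proj₁ uv))
    ...       | inj₁ refl = record
                  { centre = z ; left = uz ; right = zv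
                  ; left-leaf = y-leaf ; centre-nbrs = z-nbrs′ ; right-leaf = w-leaf }

  improve-or-cherry : {c : Colouring} → IsForestColouring c → IsolatedIn c i u v →
                      ColourEdge c j u z → z ≢ v →
                      Improvement c u v ⊎ Cherry c j u v
  improve-or-cherry {v = v} {c = c} fc uv uz z≢v
    with j≢i ← IsolatedIn-colour≢ c uv uz z≢v
    with improve-or-leaves {c = c} fc uv j≢i | improve-or-leaves {c = c} fc (IsolatedIn-sym c uv) j≢i
  ... | inj₁ better   | _            = inj₁ better
  ... | inj₂ _        | inj₁ better  = inj₁ (Improvement-sym better)
  ... | inj₂ u-leaves | inj₂ v-leaves with near? c u-leaves v
  ...   | yes v-near = inj₂ (Near⇒Cherry c u-leaves v-leaves uv j≢i v-near)
  ...   | no v-far   =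
    inj₁ (improve-by-bridge fc uv (Near c u-leaves) (Near-closed c u-leaves) (inj₁ refl) v-far uz z≢v)

  module DetachCentre (c : Colouring) (fc : IsForestColouring c) {i u v} (uv : IsolatedIn c i u v)
                      {j} (ch : Cherry c j u v) where

    open Cherry ch public

    private
      j≢i : j ≢ i
      j≢i = IsolatedIn-colour≢ c uv left (ColourEdge-irrefl c right)

    open Attach c fc uv left (ColourEdge-irrefl c right) public

    centre-isolated : IsolatedIn c′ j centre v
    centre-isolated = ColourEdge⁺ right ¬zv-uz , centre-nbrs′ , λ w r → right-leaf w (ColourEdge⁻-≢ j≢i r)
      where
      ¬zv-uz : ¬ SameEdge centre v u centre
      ¬zv-uz (inj₁ (z≡u , _)) = ColourEdge-irrefl c left (sym z≡u)
      ¬zv-uz (inj₂ (_ , v≡u)) = ColourEdge-irrefl c (proj₁ uv) (sym v≡u)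

      centre-nbrs′ : NbrsIn₁ c′ j centre v
      centre-nbrs′ w r with centre-nbrs w (ColourEdge⁻-≢ j≢i r)
      ... | inj₁ refl = contradiction (trans (sym (proj₂ r)) (colour-on (inj₂ (refl , refl)))) j≢i
      ... | inj₂ w≡v  = w≡v

    isolated⊆ : ∀ {x y} → IsolatedEdge c′ x y → IsolatedEdge c x y ⊎ SameEdge x y centre v
    isolated⊆ iso = Sum.map₂ [ orphan-right , SameEdge-sym ∘ orphan-right ]′ (isolated⁻ iso)
      where
      orphan-right : ∀ {x y} → Orphan c j u centre x y → SameEdge x y centre v
      orphan-right (_ , inj₁ (refl , refl) , uy , y≢z , _) = contradiction (left-leaf _ uy) y≢z
      orphan-right (_ , inj₂ (refl , refl) , zy , y≢u , _) =
        inj₁ (refl , [ (λ y≡u → contradiction y≡u y≢u) , id ]′ (centre-nbrs _ zy))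

    lift : Improvement c′ centre v → Improvement c u v
    lift = Improvement-via c′ isolated⊆ uv-attached

  -- Once the j-centre z is detached, the isolated edge zv joins the l-cherry, which misses z.
  improve-two-cherries : {c : Colouring} → IsForestColouring c → IsolatedIn c i u v →
                         Cherry c j u v → Cherry c l u v → l ≢ j → Improvement c u v
  improve-two-cherries {i = i} {u = u} {v = v} {j = j} {l = l} {c = c} fc uv chⱼ chₗ l≢j =
    lift (Improvement-sym (improve-by-bridge forest′ (IsolatedIn-sym c′ centre-isolated)
      L.Vertex closed (inj₂ (inj₂ refl)) centre∉ v-l-centre (centre≢ ∘ sym)))
    where
    open DetachCentre c fc uv chⱼ
    module L = Cherry chₗ

    closed : ∀ {x y} → ColourEdge c′ l x y → L.Vertex x → L.Vertex y
    closed = L.Vertex-closed ∘ ColourEdge⁻-≢ (IsolatedIn-colour≢ c uv L.left (ColourEdge-irrefl c L.right))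

    centre≢ : centre ≢ L.centre
    centre≢ e = l≢j (trans (sym (proj₂ L.left)) (trans (cong (colour c u) (sym e)) (proj₂ left)))

    centre∉ : ¬ L.Vertex centre
    centre∉ (inj₁ z≡u)        = ColourEdge-irrefl c left (sym z≡u)
    centre∉ (inj₂ (inj₁ e))   = centre≢ e
    centre∉ (inj₂ (inj₂ z≡v)) = ColourEdge-irrefl c right z≡v

    v-l-centre : ColourEdge c′ l v L.centre
    v-l-centre = ColourEdge⁺ (ColourEdge-sym c L.right) ¬vy-uz
      where
      ¬vy-uz : ¬ SameEdge v L.centre u centre
      ¬vy-uz (inj₁ (v≡u , _)) = ColourEdge-irrefl c (proj₁ uv) (sym v≡u)
      ¬vy-uz (inj₂ (v≡z , _)) = ColourEdge-irrefl c right (sym v≡z)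

  improve-cherry-at-end : {c : Colouring} → IsForestColouring c → IsolatedIn c i u v →
                          (ch : Cherry c j u v) →
                          Edge G u y → y ≢ v → y ≢ Cherry.centre ch → Improvement c u v
  improve-cherry-at-end fc uv ch uy y≢v y≢centre =
    [ id , (λ chₗ → improve-two-cherries fc uv ch chₗ λ l≡j → y≢centre (Cherry.left-leaf ch _ (uy , l≡j))) ]′
      (improve-or-cherry fc uv (uy , refl) y≢v)

  improve-cherry-at-centre : {c : Colouring} → IsForestColouring c → IsolatedIn c i u v →
                             (ch : Cherry c j u v) →
                             Edge G (Cherry.centre ch) y → y ≢ u → y ≢ v → Improvement c u v
  improve-cherry-at-centre {u = u} {v = v} {y = y} {c = c} fc uv ch zy y≢u y≢v =
    [ lift , via-v ]′ (improve-or-cherry forest′ centre-isolated (zy , refl) y≢v)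
    where
    open DetachCentre c fc uv ch

    via-v : Cherry c′ (colour c′ centre y) centre v → Improvement c u v
    via-v ch′ = Improvement-sym
      (improve-cherry-at-end fc (IsolatedIn-sym c uv) (Cherry-sym ch) vy y≢u (Edge-irrefl zy ∘ sym))
      where
      vy : Edge G v y
      vy = Edge-sym (subst (λ t → Edge G t v) (sym (Cherry.left-leaf ch′ y (zy , refl)))
                           (proj₁ (Cherry.right ch′)))

  #isolated : Colouring → ℕ
  #isolated c = ∑ λ x → ∑ λ y → ⟦ isolatedEdge? c x y ⟧

  #isolated-< : {c : Colouring} (better : Improvement c u v) → IsolatedEdge c u v →
                #isolated (Improvement.colouring better) < #isolated c
  #isolated-< {u = u} {v = v} {c = c} better uv =
    ∑-mono-< (λ x → ∑-mono-≤ (λ y → ≤-at x y)) u (∑-mono-< (≤-at u) v (⟦⟧-mono-< unisolates uv _ _))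
    where
    open Improvement better
    ≤-at : ∀ x y → ⟦ isolatedEdge? colouring x y ⟧ ≤ ⟦ isolatedEdge? c x y ⟧
    ≤-at x y = ⟦⟧-mono-≤ isolated⊆ _ _

  isolation-free⇒NoSingleEdgeComponent : (c : Colouring) → (∀ {x y} → ¬ IsolatedEdge c x y) →
                                         NoSingleEdgeComponent c
  isolation-free⇒NoSingleEdgeComponent c none i u v uv
    with any? (λ w → ¬? (w ≟ v) ×-dec colourEdge? c i u w) | any? (λ w → ¬? (w ≟ u) ×-dec colourEdge? c i v w)
  ... | yes u-other | _           = inj₁ u-other
  ... | no _        | yes v-other = inj₂ v-other
  ... | no ¬u       | no ¬v       = ⊥-elim (none (i , uv , NbrsIn₁-from c ¬u , NbrsIn₁-from c ¬v))

  module _ (¬K2 : ¬ HasK2Component G) (¬K3 : ¬ HasK3Component G) where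

    improve-cherry : {c : Colouring} → IsForestColouring c → IsolatedIn c i u v → Cherry c j u v →
                     Improvement c u v
    improve-cherry {u = u} {v = v} {c = c} fc uv ch =
      decide (nbrOutside? vertex? u) (nbrOutside? vertex? v) (nbrOutside? vertex? centre)
      where
      open Cherry ch

      decide : Dec (NbrOutside Vertex u) → Dec (NbrOutside Vertex v) → Dec (NbrOutside Vertex centre) →
               Improvement c u v
      decide (yes (y , uy , y∉)) _ _ = improve-cherry-at-end fc uv ch uy (y∉ ∘ inj₂ ∘ inj₂) (y∉ ∘ inj₂ ∘ inj₁)
      decide (no _) (yes (y , vy , y∉)) _ = Improvement-sym
        (improve-cherry-at-end fc (IsolatedIn-sym c uv) (Cherry-sym ch) vy (y∉ ∘ inj₁) (y∉ ∘ inj₂ ∘ inj₁))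
      decide (no _) (no _) (yes (y , zy , y∉)) =
        improve-cherry-at-centre fc uv ch zy (y∉ ∘ inj₁) (y∉ ∘ inj₂ ∘ inj₂)
      decide (no ¬u) (no ¬v) (no ¬z) =
        ⊥-elim (¬K3 (u , centre , v , proj₁ left , proj₁ right , proj₁ (proj₁ uv) ,
          λ x → [ nbrs-within vertex? ¬u x , [ nbrs-within vertex? ¬z x , nbrs-within vertex? ¬v x ]′ ]′))

    improve-at : {c : Colouring} → IsForestColouring c → IsolatedIn c i u v → Edge G u z → z ≢ v →
                 Improvement c u v
    improve-at fc uv uz z≢v = [ id , improve-cherry fc uv ]′ (improve-or-cherry fc uv (uz , refl) z≢v)

    improve : {c : Colouring} → IsForestColouring c → IsolatedEdge c u v → Improvement c u v
    improve {u = u} {v = v} {c = c} fc (_ , uv) = decide (nbrOutside? (_≟ v) u) (nbrOutside? (_≟ u) v)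
      where
      decide : Dec (NbrOutside (_≡ v) u) → Dec (NbrOutside (_≡ u) v) → Improvement c u v
      decide (yes (z , uz , z≢v)) _ = improve-at fc uv uz z≢v
      decide (no _) (yes (z , vz , z≢u)) = Improvement-sym (improve-at fc (IsolatedIn-sym c uv) vz z≢u)
      decide (no ¬u) (no ¬v) =
        ⊥-elim (¬K2 (u , v , proj₁ (proj₁ uv) , nbrs-within (_≟ v) ¬u , nbrs-within (_≟ u) ¬v))

    isolation-free : ∀ r (c : Colouring) → IsForestColouring c → #isolated c < r →
                     Σ[ c′ ∈ Colouring ] IsForestColouring c′ × (∀ {x y} → ¬ IsolatedEdge c′ x y)
    isolation-free (suc r) c fc #c<r with any? (λ x → any? (λ y → isolatedEdge? c x y))
    ... | no none = c , fc , λ iso → none (_ , _ , iso)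
    ... | yes (u , v , uv) =
      isolation-free r colouring forest (ℕ.<-≤-trans (#isolated-< better uv) (s≤s⁻¹ #c<r))
      where
      better : Improvement c u v
      better = improve fc uv
      open Improvement better

    single-edge-free : HasForestColouring G k →
                       Σ[ c ∈ Colouring ] IsForestColouring c × NoSingleEdgeComponent c
    single-edge-free (c , fc) with isolation-free (suc (#isolated c)) c fc ℕ.≤-refl
    ... | c′ , fc′ , none = c′ , fc′ , isolation-free⇒NoSingleEdgeComponent c′ none

lemma1 : ∀ {n} (G : Graph n) → ¬ HasK2Component G → ¬ HasK3Component G →
    ∀ (k : ℕ) → IsArboricity G k →
    Σ (EdgeColouring G k) λ c → IsForestColouring c × NoSingleEdgeComponent c
lemma1 G ¬K2 ¬K3 k (has-forest-colouring , _) = single-edge-free G ¬K2 ¬K3 has-forest-colouring
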